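{- For every positive integer $n$ and every integer $k\geq1$, $$\sigma_{k+1}^{\mathrm{odd}}(n)\leq\partial^k(\sigma_{k+1}(n)).$$
   Context: $\sigma_k(n)$ (resp. $\sigma_k^{\mathrm{odd}}(n)$) denotes the number of square-free positive integers (resp. odd square-free positive integers) $\leq n$ with exactly $k$ prime factors. For integers $k\geq0$ and $N\geq1$ write uniquely $N=\binom{a_{k+1}}{k+1}+\binom{a_k}{k}+\cdots+\binom{a_i}{i}$ with $a_{k+1}>a_k>\cdots>a_i\geq i\geq1$, and define $\partial^k(N)=\sum_{t=i}^{k+1}\binom{a_t-1}{t}$ (with $\binom{p}{q}=0$ for $0\le p<q$); set $\partial^k(0)=0$. -}

module Defs where

open import Data.Nat using (ℕ; zero; suc; _+_; _*_; _∸_; _≤_; _<_; _>_; _≤?_; _≟_)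
open import Data.Nat.Properties using (allUpTo?)
open import Data.Nat.Divisibility using (_∣_; _∣?_)
open import Data.Nat.Primality using (Prime; prime?)
open import Data.Nat.Combinatorics using (_C_)
open import Data.List using (List; []; _∷_; length; filter; upTo)
open import Data.List.Relation.Unary.All using (All)
open import Data.List.Relation.Unary.Linked using (Linked)
open import Data.Product using (Σ; _×_)
open import Data.Sum using (_⊎_)
open import Relation.Nullary using (¬_; Dec)
open import Relation.Nullary.Decidable using (_×-dec_; _→-dec_; ¬?)
open import Relation.Binary.PropositionalEquality using (_≡_)

-- m is square-free: no square d*d with d ≥ 2 divides m
-- (for m ≥ 1 any such d satisfies d ≤ m, so the bound d < suc m is harmless)
SquareFree : ℕ → Set
SquareFree m = ∀ {d} → d < suc m → (2 ≤ d → ¬ (d * d ∣ m))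

squareFree? : (m : ℕ) → Dec (SquareFree m)
squareFree? m = allUpTo? (λ d → 2 ≤? d →-dec ¬? (d * d ∣? m)) (suc m)

ω : ℕ → ℕ
ω m = length (filter (λ p → prime? p ×-dec p ∣? m) (upTo (suc m)))

σ : ℕ → ℕ → ℕ
σ k n = length (filter (λ m → 1 ≤? m ×-dec (squareFree? m ×-dec ω m ≟ k)) (upTo (suc n)))

σodd : ℕ → ℕ → ℕ
σodd k n = length (filter (λ m → 1 ≤? m ×-dec (¬? (2 ∣? m) ×-dec (squareFree? m ×-dec ω m ≟ k))) (upTo (suc n)))

binomSum : ℕ → List ℕ → ℕ
binomSum t []       = 0
binomSum t (a ∷ as) = a C t + binomSum (t ∸ 1) as

shadowSum : ℕ → List ℕ → ℕ
shadowSum t []       = 0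
shadowSum t (a ∷ as) = (a ∸ 1) C t + shadowSum (t ∸ 1) as

-- as = [a_{k+1}, a_k, …, a_i] is a (k+1)-binomial (Macaulay) representation of N:
-- i = k + 2 - length as, 1 ≤ i ≤ k+1, a_{k+1} > … > a_i ≥ i, and N = Σ C(a_t, t).
IsMacaulayRep : ℕ → ℕ → List ℕ → Set
IsMacaulayRep k N as =
  1 ≤ length as × length as ≤ suc k × Linked _>_ as
  × All (λ a → suc (suc k) ∸ length as ≤ a) as × binomSum (suc k) as ≡ N

IsShadow : ℕ → ℕ → ℕ → Set
IsShadow k N d =
  (N ≡ 0 × d ≡ 0)
  ⊎ Σ (List ℕ) (λ as → IsMacaulayRep k N as × d ≡ shadowSum (suc k) as)

-- Let A(t, c, p) be the number of square-free p-rough m with t prime factors and c·m ≤ n, so that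
-- σ_{k+1}(n) = A(k+1, 1, 2) and σ^odd_{k+1}(n) = A(k+1, 1, 3). Splitting by divisibility by a prime p
-- gives A(t+1, c, p) = A(t, cp, p+1) + A(t+1, c, p+1), and removing one prime (necessarily ≥ p) from a
-- number counted by A(t+1, c, p) yields one counted by A(t, c′, p) whenever c′ ≤ cp. So these families
-- behave like compressed set systems, and a Kruskal–Katona argument, by induction on n − p, shows for
-- N = Σ C(a_s, s) ≤ A(t+1, c, p) that A(t, c′, p) ≥ Σ C(a_s, s−1) and, for p prime, that the multiples
-- of p number A(t, cp, p+1) ≥ Σ C(a_s − 1, s − 1): otherwise the non-multiples, a family at p + 1, would
-- number more than Σ C(a_s − 1, s), and the shadow bound at p + 1 would give their shadow, which is
-- counted by A(t, cp, p+1), at least Σ C(a_s − 1, s − 1) elements.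
-- For p = 2 and N = σ_{k+1}(n), Pascal's rule N = Σ C(a_s − 1, s − 1) + ∂^k(N) leaves at most ∂^k(N)
-- for the odd part N − A(k, 2, 3).

module Submission where

open import Defs
open import Data.Empty using (⊥-elim)
open import Data.List using (List; []; _∷_; [_]; _++_; length; filter; upTo)
open import Data.List.Properties using (upTo-∷ʳ; filter-++; length-++; filter-accept; filter-reject)
open import Data.List.Relation.Unary.All using (All; []; _∷_)
open import Data.List.Relation.Unary.Linked using (Linked; []; [-]; _∷_)
open import Data.Nat
open import Data.Nat.Combinatorics using (_C_; nCk+nC[k+1]≡[n+1]C[k+1]; nCn≡1; nC1≡n)
open import Data.Nat.Coprimality using (Coprime; coprime-divisor; prime⇒coprime) renaming (sym to coprime-sym)
open import Data.Nat.Divisibility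
open import Data.Nat.Primality
open import Data.Nat.Properties
open import Algebra.Properties.CommutativeSemigroup +-commutativeSemigroup using (interchange)
open import Data.Product using (Σ; ∃-syntax; ∃₂; _×_; _,_; proj₂)
open import Data.Sum using (inj₁; inj₂; [_,_]′)
open import Function using (_∘_)
open import Level using (0ℓ)
open import Relation.Nullary using (¬_; Dec; yes; no; contradiction)
open import Relation.Nullary.Decidable using (_×-dec_; ¬?; map′)
open import Relation.Unary using (Pred; Decidable)
open import Relation.Binary.PropositionalEquality using (_≡_; _≢_; refl; sym; trans; cong; cong₂; subst; module ≡-Reasoning)

-- Counting below a bound

module _ {ℓ} {P : Pred ℕ ℓ} (P? : Decidable P) where

  count : ℕ → ℕ
  count n = length (filter P? (upTo n))

  private
    count-suc : ∀ n → count (suc n) ≡ count n + length (filter P? [ n ])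
    count-suc n = begin
      length (filter P? (upTo (suc n)))              ≡⟨ cong (length ∘ filter P?) (upTo-∷ʳ n) ⟨
      length (filter P? (upTo n ++ [ n ]))           ≡⟨ cong length (filter-++ P? (upTo n) [ n ]) ⟩
      length (filter P? (upTo n) ++ filter P? [ n ]) ≡⟨ length-++ (filter P? (upTo n)) ⟩
      count n + length (filter P? [ n ])             ∎
      where open ≡-Reasoning

  count-yes : ∀ {n} → P n → count (suc n) ≡ suc (count n)
  count-yes {n} p = trans (count-suc n)
    (trans (cong (λ xs → count n + length xs) (filter-accept P? p)) (+-comm (count n) 1))

  count-no : ∀ {n} → ¬ P n → count (suc n) ≡ count n
  count-no {n} ¬p = trans (count-suc n)
    (trans (cong (λ xs → count n + length xs) (filter-reject P? ¬p)) (+-identityʳ (count n)))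

  count-≡0 : ∀ n → (∀ {m} → m < n → ¬ P m) → count n ≡ 0
  count-≡0 zero    _  = refl
  count-≡0 (suc n) ¬P = trans (count-no (¬P ≤-refl)) (count-≡0 n (λ m<n → ¬P (m<n⇒m<1+n m<n)))

  count-stable : ∀ {n N} → n ≤ N → (∀ {m} → n ≤ m → ¬ P m) → count N ≡ count n
  count-stable {N = zero}  z≤n   _  = refl
  count-stable {N = suc N} n≤1+N ¬P with m≤n⇒m<n∨m≡n n≤1+N
  ... | inj₂ refl      = refl
  ... | inj₁ (s≤s n≤N) = trans (count-no (¬P n≤N)) (count-stable n≤N ¬P)

count-≟ : ∀ {p n} → p < n → count (_≟ p) n ≡ 1
count-≟ {p} {suc n} (s≤s p≤n) with m≤n⇒m<n∨m≡n p≤n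
... | inj₂ refl = trans (count-yes (_≟ p) refl) (cong suc (count-≡0 (_≟ p) n (λ m<n → <⇒≢ m<n)))
... | inj₁ p<n  = trans (count-no (_≟ p) (>⇒≢ p<n)) (count-≟ p<n)

module _ {ℓ ℓ′} {P : Pred ℕ ℓ} {Q : Pred ℕ ℓ′} (P? : Decidable P) (Q? : Decidable Q) where

  count-mono : ∀ n → (∀ {m} → m < n → P m → Q m) → count P? n ≤ count Q? n
  count-mono zero    _   = z≤n
  count-mono (suc n) P⇒Q with ih ← count-mono n (λ m<n → P⇒Q (m<n⇒m<1+n m<n)) | P? n | Q? n
  ... | yes p | yes q rewrite count-yes P? p | count-yes Q? q = s≤s ih
  ... | yes p | no ¬q = contradiction (P⇒Q ≤-refl p) ¬q
  ... | no ¬p | yes q rewrite count-no P? ¬p | count-yes Q? q = m≤n⇒m≤1+n ih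
  ... | no ¬p | no ¬q rewrite count-no P? ¬p | count-no Q? ¬q = ih

  count-split : ∀ n → count P? n ≡ count (λ m → P? m ×-dec Q? m) n + count (λ m → P? m ×-dec ¬? (Q? m)) n
  count-split zero = refl
  count-split (suc n) with ih ← count-split n | P? n | Q? n
  ... | yes p | yes q
    rewrite count-yes P? p | count-yes (λ m → P? m ×-dec Q? m) (p , q)
          | count-no (λ m → P? m ×-dec ¬? (Q? m)) (λ (_ , ¬q) → ¬q q) = cong suc ih
  ... | yes p | no ¬q
    rewrite count-yes P? p | count-no (λ m → P? m ×-dec Q? m) (λ (_ , q) → ¬q q)
          | count-yes (λ m → P? m ×-dec ¬? (Q? m)) (p , ¬q) = trans (cong suc ih) (sym (+-suc _ _))
  ... | no ¬p | _
    rewrite count-no P? ¬p | count-no (λ m → P? m ×-dec Q? m) (λ (p , _) → ¬p p)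
          | count-no (λ m → P? m ×-dec ¬? (Q? m)) (λ (p , _) → ¬p p) = ih

module _ {ℓ ℓ′} {P : Pred ℕ ℓ} {Q : Pred ℕ ℓ′} (P? : Decidable P) (Q? : Decidable Q) where

  count-cong : ∀ n → (∀ {m} → m < n → P m → Q m) → (∀ {m} → m < n → Q m → P m) →
               count P? n ≡ count Q? n
  count-cong n P⇒Q Q⇒P = ≤-antisym (count-mono P? Q? n P⇒Q) (count-mono Q? P? n Q⇒P)

module _ {ℓ} {Q : Pred ℕ ℓ} (Q? : Decidable Q) (q : ℕ) .{{_ : NonZero q}} where

  private
    Q∣? : Decidable (λ m → Q m × q ∣ m)
    Q∣? m = Q? m ×-dec q ∣? m

    count-between-multiples : ∀ {M} j → j < q → count Q∣? (suc j + q * M) ≡ count Q∣? (suc (q * M))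
    count-between-multiples zero        _     = refl
    count-between-multiples {M} (suc j) 1+j<q =
      trans (count-no Q∣? (λ (_ , q∣) → <⇒≱ 1+j<q (∣⇒≤ (∣m+n∣m⇒∣n (subst (q ∣_) (+-comm _ (q * M)) q∣) (m∣m*n M)))))
            (count-between-multiples j (<-trans (n<1+n j) 1+j<q))

  count-multiples : ∀ M → count (λ m → Q? m ×-dec q ∣? m) (q * M) ≡ count (Q? ∘ (q *_)) M
  count-multiples zero    rewrite *-zeroʳ q = refl
  count-multiples (suc M) = begin
    count Q∣? (q * suc M)            ≡⟨ cong (count Q∣?) (trans (*-suc q M) (cong (_+ q * M) (sym (suc-pred q)))) ⟩
    count Q∣? (suc (pred q) + q * M) ≡⟨ count-between-multiples (pred q) (≤-reflexive (suc-pred q)) ⟩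
    count Q∣? (suc (q * M))          ≡⟨ last-multiple (Q? (q * M)) ⟩
    count (Q? ∘ (q *_)) (suc M)      ∎
    where
    open ≡-Reasoning
    last-multiple : Dec (Q (q * M)) → count Q∣? (suc (q * M)) ≡ count (Q? ∘ (q *_)) (suc M)
    last-multiple (yes Q[qM]) = trans (count-yes Q∣? (Q[qM] , m∣m*n M))
      (trans (cong suc (count-multiples M)) (sym (count-yes (Q? ∘ (q *_)) Q[qM])))
    last-multiple (no ¬Q[qM]) = trans (count-no Q∣? (λ (Q[qM] , _) → ¬Q[qM] Q[qM]))
      (trans (count-multiples M) (sym (count-no (Q? ∘ (q *_)) ¬Q[qM])))

-- Binomial coefficients and Macaulay representations

C-pascal : ∀ n k → suc n C suc k ≡ n C k + n C suc k
C-pascal n k = sym (nCk+nC[k+1]≡[n+1]C[k+1] n k)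

C-pascal-∸1 : ∀ {a} k → 0 < a → a C suc k ≡ (a ∸ 1) C k + (a ∸ 1) C suc k
C-pascal-∸1 {suc a} k _ = C-pascal a k

nCk≤[1+n]Ck : ∀ n k → n C k ≤ suc n C k
nCk≤[1+n]Ck n zero    = ≤-refl
nCk≤[1+n]Ck n (suc k) = subst (n C suc k ≤_) (sym (C-pascal n k)) (m≤n+m _ _)

C-monoˡ-≤ : ∀ {m n} k → m ≤ n → m C k ≤ n C k
C-monoˡ-≤ {n = zero}  k z≤n   = ≤-refl
C-monoˡ-≤ {n = suc n} k m≤1+n with m≤n⇒m<n∨m≡n m≤1+n
... | inj₂ refl      = ≤-refl
... | inj₁ (s≤s m≤n) = ≤-trans (C-monoˡ-≤ k m≤n) (nCk≤[1+n]Ck n k)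

0<nCk : ∀ {n k} → k ≤ n → 0 < n C k
0<nCk {k = zero}              _         = s≤s z≤n
0<nCk {suc n} {suc k} (s≤s k≤n) = subst (0 <_) (sym (C-pascal n k)) (<-≤-trans (0<nCk k≤n) (m≤m+n _ _))

n<[n+1+k]C[1+k] : ∀ n k → n < (n + suc k) C suc k
n<[n+1+k]C[1+k] n zero    = ≤-reflexive (sym (trans (nC1≡n (n + 1)) (+-comm n 1)))
n<[n+1+k]C[1+k] n (suc k) = begin-strict
  n                                                  <⟨ n<[n+1+k]C[1+k] n k ⟩
  (n + suc k) C suc k                                ≤⟨ m≤m+n _ _ ⟩
  (n + suc k) C suc k + (n + suc k) C suc (suc k)    ≡⟨ C-pascal (n + suc k) (suc k) ⟨
  suc (n + suc k) C suc (suc k)                      ≡⟨ cong (_C suc (suc k)) (+-suc n (suc k)) ⟨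
  (n + suc (suc k)) C suc (suc k)                    ∎
  where open ≤-Reasoning

-- Macaulay t [a_t, a_{t-1}, …, a_i]: a_t > a_{t-1} > … > a_i ≥ i ≥ 1, the entry a_s standing for C(a_s, s).
data Macaulay : ℕ → List ℕ → Set where
  []  : ∀ {t} → Macaulay t []
  [-] : ∀ {t a} → suc t ≤ a → Macaulay (suc t) (a ∷ [])
  _∷_ : ∀ {t a b bs} → b < a → Macaulay (suc t) (b ∷ bs) → Macaulay (suc (suc t)) (a ∷ b ∷ bs)

-- Σ C(a_s - 1, s - 1): in the colex-initial family represented by as, the sets containing the least element.
starSum : ℕ → List ℕ → ℕ
starSum _       []       = 0
starSum zero    (_ ∷ _)  = 0
starSum (suc t) (a ∷ as) = (a ∸ 1) C t + starSum t as

-- Σ C(a_s, s - 1): the Kruskal–Katona lower bound for the shadow.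
kkShadow : ℕ → List ℕ → ℕ
kkShadow _       []       = 0
kkShadow zero    (_ ∷ _)  = 0
kkShadow (suc t) (a ∷ as) = a C t + kkShadow t as

lowerRep : ℕ → List ℕ → List ℕ
lowerRep _             []       = []
lowerRep (suc (suc t)) (a ∷ as) = (a ∸ 1) ∷ lowerRep (suc t) as
lowerRep _             (_ ∷ _)  = []

Macaulay-level≤head : ∀ {t a as} → Macaulay t (a ∷ as) → t ≤ a
Macaulay-level≤head ([-] t<a)   = t<a
Macaulay-level≤head (b<a ∷ rep) = ≤-trans (s≤s (Macaulay-level≤head rep)) b<a

Macaulay-0<head : ∀ {t a as} → Macaulay t (a ∷ as) → 0 < a
Macaulay-0<head ([-] t<a)  = <-≤-trans z<s t<a
Macaulay-0<head (b<a ∷ _)  = <-≤-trans z<s b<a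

0<binomSum : ∀ {t a as} → Macaulay t (a ∷ as) → 0 < binomSum t (a ∷ as)
0<binomSum rep = <-≤-trans (0<nCk (Macaulay-level≤head rep)) (m≤m+n _ _)

private
  <⇒≤∸1 : ∀ {b a} → b < a → b ≤ a ∸ 1
  <⇒≤∸1 {a = suc _} (s≤s b≤a) = b≤a

  pascal-interchange : ∀ {a} k x y → 0 < a → a C suc k + (x + y) ≡ ((a ∸ 1) C k + x) + ((a ∸ 1) C suc k + y)
  pascal-interchange {a} k x y 0<a = trans (cong (_+ (x + y)) (C-pascal-∸1 k 0<a)) (interchange ((a ∸ 1) C k) ((a ∸ 1) C suc k) x y)

binomSum≡starSum+shadowSum : ∀ {t as} → Macaulay t as → binomSum t as ≡ starSum t as + shadowSum t as
binomSum≡starSum+shadowSum []                  = refl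
binomSum≡starSum+shadowSum {suc t} rep@([-] _) = pascal-interchange t 0 0 (Macaulay-0<head rep)
binomSum≡starSum+shadowSum {suc (suc t)} {a ∷ _} rep@(_ ∷ rep′) =
  trans (cong (a C suc (suc t) +_) (binomSum≡starSum+shadowSum rep′)) (pascal-interchange (suc t) _ _ (Macaulay-0<head rep))

kkShadow≡kkShadow[lowerRep]+starSum : ∀ {t as} → Macaulay (suc t) as →
  kkShadow (suc t) as ≡ kkShadow t (lowerRep (suc t) as) + starSum (suc t) as
kkShadow≡kkShadow[lowerRep]+starSum         []                = refl
kkShadow≡kkShadow[lowerRep]+starSum {zero}  ([-] _)           = refl
kkShadow≡kkShadow[lowerRep]+starSum {suc t} rep@([-] _)       = pascal-interchange t 0 0 (Macaulay-0<head rep)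
kkShadow≡kkShadow[lowerRep]+starSum {suc t} {a ∷ _} rep@(_ ∷ rep′) =
  trans (cong (a C suc t +_) (kkShadow≡kkShadow[lowerRep]+starSum rep′)) (pascal-interchange t _ _ (Macaulay-0<head rep))

binomSum[lowerRep]≤starSum : ∀ {t as} → Macaulay (suc t) as → binomSum t (lowerRep (suc t) as) ≤ starSum (suc t) as
binomSum[lowerRep]≤starSum          []          = z≤n
binomSum[lowerRep]≤starSum {zero}   ([-] _)     = z≤n
binomSum[lowerRep]≤starSum {suc _}  ([-] _)     = ≤-refl
binomSum[lowerRep]≤starSum          (_ ∷ rep)   = +-monoʳ-≤ _ (binomSum[lowerRep]≤starSum rep)

lowerRep-Macaulay : ∀ {t as} → Macaulay (suc t) as → Macaulay t (lowerRep (suc t) as)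
lowerRep-Macaulay []                                        = []
lowerRep-Macaulay {zero}  ([-] _)                           = []
lowerRep-Macaulay {suc _} ([-] {a = suc _} (s≤s 1+t≤a))     = [-] 1+t≤a
lowerRep-Macaulay {1}     (b<a ∷ rep)                       = [-] (≤-trans (Macaulay-level≤head rep) (<⇒≤∸1 b<a))
lowerRep-Macaulay {2+ _}  (_∷_ {a = suc _} {b = suc _} (s≤s b<a) rep) = b<a ∷ lowerRep-Macaulay rep
lowerRep-Macaulay {2+ _}  (_∷_ {b = zero} _ rep)            = contradiction (Macaulay-level≤head rep) λ ()

starSum≤C : ∀ {t a as} → Macaulay (suc t) (a ∷ as) → starSum (suc t) (a ∷ as) ≤ a C t
starSum≤C {t} {a} ([-] _) = ≤-trans (≤-reflexive (+-identityʳ _)) (C-monoˡ-≤ t (m∸n≤m a 1))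
starSum≤C {suc t} {a} {b ∷ bs} rep@(b<a ∷ rep′) = begin
  (a ∸ 1) C suc t + starSum (suc t) (b ∷ bs) ≤⟨ +-monoʳ-≤ _ (starSum≤C rep′) ⟩
  (a ∸ 1) C suc t + b C t                    ≤⟨ +-monoʳ-≤ _ (C-monoˡ-≤ t (<⇒≤∸1 b<a)) ⟩
  (a ∸ 1) C suc t + (a ∸ 1) C t              ≡⟨ +-comm ((a ∸ 1) C suc t) _ ⟩
  (a ∸ 1) C t + (a ∸ 1) C suc t              ≡⟨ C-pascal-∸1 t (Macaulay-0<head rep) ⟨
  a C suc t                                  ∎
  where open ≤-Reasoning

starSum≤kkShadow[1+shadowSum] : ∀ {t a as} → Macaulay (suc t) (a ∷ as) →
  ∃₂ λ b bs → Macaulay (suc t) (b ∷ bs)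
            × binomSum (suc t) (b ∷ bs) ≤ suc (shadowSum (suc t) (a ∷ as))
            × starSum (suc t) (a ∷ as) ≤ kkShadow (suc t) (b ∷ bs)
starSum≤kkShadow[1+shadowSum] {t} {suc a} rep@([-] _) with a C t ≤? 1
... | yes aCt≤1 = suc a , [] , rep , ≤-trans (≤-reflexive (cong (_+ 0) (C-pascal a t))) (+-monoˡ-≤ 0 (+-monoˡ-≤ (a C suc t) aCt≤1)) ,
                  +-monoˡ-≤ 0 (nCk≤[1+n]Ck a t)
starSum≤kkShadow[1+shadowSum] {zero}          ([-] _)         | no aC0≰1 = contradiction ≤-refl aC0≰1
starSum≤kkShadow[1+shadowSum] {suc t} {suc a} ([-] (s≤s t<a)) | no aCt≰1 with m≤n⇒m<n∨m≡n t<a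
... | inj₂ refl = contradiction (≤-reflexive (nCn≡1 (suc t))) aCt≰1
... | inj₁ 1+t<a = a , suc t ∷ [] , 1+t<a ∷ [-] ≤-refl ,
                   ≤-reflexive (trans (cong (λ c → a C suc (suc t) + (c + 0)) (nCn≡1 (suc t))) (+-suc _ 0)) ,
                   +-monoʳ-≤ (a C suc t) z≤n
starSum≤kkShadow[1+shadowSum] {suc t} {a} {b ∷ bs} rep@(b<a ∷ rep′)
  with d , ds , repd , binom≤ , star≤ ← starSum≤kkShadow[1+shadowSum] rep′ | d <? a ∸ 1
... | yes d<a∸1 = a ∸ 1 , d ∷ ds , d<a∸1 ∷ repd ,
                  ≤-trans (+-monoʳ-≤ ((a ∸ 1) C suc (suc t)) binom≤) (≤-reflexive (+-suc ((a ∸ 1) C suc (suc t)) (shadowSum (suc t) (b ∷ bs)))) ,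
                  +-monoʳ-≤ ((a ∸ 1) C suc t) star≤
... | no  d≮a∸1 = a , [] , [-] (Macaulay-level≤head rep) , binom≤′ , ≤-trans (starSum≤C rep) (≤-reflexive (sym (+-identityʳ _)))
  where
  open ≤-Reasoning
  lo = shadowSum (suc t) (b ∷ bs)
  binom≤′ : a C suc (suc t) + 0 ≤ suc ((a ∸ 1) C suc (suc t) + lo)
  binom≤′ = begin
    a C suc (suc t) + 0                                ≡⟨ +-identityʳ _ ⟩
    a C suc (suc t)                                    ≡⟨ C-pascal-∸1 (suc t) (Macaulay-0<head rep) ⟩
    (a ∸ 1) C suc t + (a ∸ 1) C suc (suc t)            ≤⟨ +-monoˡ-≤ ((a ∸ 1) C suc (suc t)) (C-monoˡ-≤ (suc t) (≮⇒≥ d≮a∸1)) ⟩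
    d C suc t + (a ∸ 1) C suc (suc t)                  ≤⟨ +-monoˡ-≤ ((a ∸ 1) C suc (suc t)) (≤-trans (m≤m+n (d C suc t) (binomSum t ds)) binom≤) ⟩
    suc lo + (a ∸ 1) C suc (suc t)                     ≡⟨ cong suc (+-comm lo ((a ∸ 1) C suc (suc t))) ⟩
    suc ((a ∸ 1) C suc (suc t) + lo)                   ∎

∃-crossing : ∀ {ℓ} {Q : Pred ℕ ℓ} → Decidable Q → ∀ {lo} k → Q lo → ¬ Q (k + lo) →
             ∃[ a ] lo ≤ a × Q a × ¬ Q (suc a)
∃-crossing Q? zero    Q[lo] ¬Q[lo] = contradiction Q[lo] ¬Q[lo]
∃-crossing Q? {lo} (suc k) Q[lo] ¬Q[1+k+lo] with Q? (k + lo)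
... | yes Q[k+lo] = k + lo , m≤n+m lo k , Q[k+lo] , ¬Q[1+k+lo]
... | no ¬Q[k+lo] = ∃-crossing Q? k Q[lo] ¬Q[k+lo]

-- a is the largest index with a C (suc t) ≤ N
greedyHead : ∀ t N → 0 < N → ∃[ a ] suc t ≤ a × a C suc t ≤ N × N ∸ a C suc t < a C t
greedyHead t N 0<N with a , 1+t≤a , aC≤N , ¬[1+a]C≤N ← ∃-crossing (λ a → a C suc t ≤? N) N
       (subst (_≤ N) (sym (nCn≡1 (suc t))) 0<N) (<⇒≱ (n<[n+1+k]C[1+k] N t))
  = a , 1+t≤a , aC≤N , +-cancelˡ-< (a C suc t) _ _ (begin-strict
      a C suc t + (N ∸ a C suc t) ≡⟨ m+[n∸m]≡n aC≤N ⟩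
      N                           <⟨ ≰⇒> ¬[1+a]C≤N ⟩
      suc a C suc t               ≡⟨ C-pascal a t ⟩
      a C t + a C suc t           ≡⟨ +-comm (a C t) _ ⟩
      a C suc t + a C t           ∎)
  where open ≤-Reasoning

private
  singleRep : ∀ {t N} a → suc t ≤ a → a C suc t ≤ N → N ∸ a C suc t ≡ 0 →
              ∃[ as ] Macaulay (suc t) as × binomSum (suc t) as ≡ N
  singleRep {t} a 1+t≤a aC≤N rem≡0 = a ∷ [] , [-] 1+t≤a , trans (cong (a C suc t +_) (sym rem≡0)) (m+[n∸m]≡n aC≤N)

  consRep : ∀ {t N} a → suc (suc t) ≤ a → a C suc (suc t) ≤ N → N ∸ a C suc (suc t) < a C suc t →
            ∃[ bs ] Macaulay (suc t) bs × binomSum (suc t) bs ≡ N ∸ a C suc (suc t) →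
            ∃[ as ] Macaulay (suc (suc t)) as × binomSum (suc (suc t)) as ≡ N
  consRep a 2+t≤a aC≤N _    ([]     , _   , 0≡rem)     = singleRep a 2+t≤a aC≤N (sym 0≡rem)
  consRep {t} a _ aC≤N rem< (b ∷ bs , rep , binom≡rem) =
    a ∷ b ∷ bs , b<a ∷ rep , trans (cong (a C suc (suc t) +_) binom≡rem) (m+[n∸m]≡n aC≤N)
    where
    b<a : b < a
    b<a = ≰⇒> λ a≤b → <⇒≱ rem< (≤-trans (C-monoˡ-≤ (suc t) a≤b) (≤-trans (m≤m+n (b C suc t) (binomSum t bs)) (≤-reflexive binom≡rem)))

macaulayRep : ∀ t N → ∃[ as ] Macaulay (suc t) as × binomSum (suc t) as ≡ N
macaulayRep t       zero    = [] , [] , refl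
macaulayRep zero    (suc N) = let a , 1≤a , aC≤N , rem<1 = greedyHead zero (suc N) z<s in
  singleRep a 1≤a aC≤N (n<1⇒n≡0 rem<1)
macaulayRep (suc t) (suc N) = let a , 2+t≤a , aC≤N , rem< = greedyHead (suc t) (suc N) z<s in
  consRep a 2+t≤a aC≤N rem< (macaulayRep t (suc N ∸ a C suc (suc t)))

Macaulay-length≤ : ∀ {t as} → Macaulay t as → length as ≤ t
Macaulay-length≤ []          = z≤n
Macaulay-length≤ ([-] _)     = s≤s z≤n
Macaulay-length≤ (_ ∷ rep)   = s≤s (Macaulay-length≤ rep)

Macaulay-linked : ∀ {t as} → Macaulay t as → Linked _>_ as
Macaulay-linked []          = []
Macaulay-linked ([-] _)     = [-]
Macaulay-linked (b<a ∷ rep) = b<a ∷ Macaulay-linked rep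

Macaulay-lowerBound : ∀ {t as} → Macaulay t as → All (λ a → suc t ∸ length as ≤ a) as
Macaulay-lowerBound []          = []
Macaulay-lowerBound ([-] t<a)   = t<a ∷ []
Macaulay-lowerBound (b<a ∷ rep) with i≤b ∷ i≤bs ← Macaulay-lowerBound rep = ≤-trans i≤b (<⇒≤ b<a) ∷ i≤b ∷ i≤bs

linked⇒Macaulay : ∀ {t as} → 0 < length as → length as ≤ t → Linked _>_ as →
                  All (λ a → suc t ∸ length as ≤ a) as → Macaulay t as
linked⇒Macaulay {suc t} {a ∷ []}     _ _          _              (t<a ∷ [])    = [-] t<a
linked⇒Macaulay {2+ t}  {a ∷ b ∷ bs} _ (s≤s len≤) (b<a ∷ linked) (_ ∷ bounds) =
  b<a ∷ linked⇒Macaulay z<s len≤ linked bounds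

isMacaulayRep⇒Macaulay : ∀ {k N as} → IsMacaulayRep k N as → Macaulay (suc k) as
isMacaulayRep⇒Macaulay (0<len , len≤ , linked , bounds , _) = linked⇒Macaulay 0<len len≤ linked bounds

shadow-exists : ∀ k N → ∃[ d ] IsShadow k N d
shadow-exists k zero = 0 , inj₁ (refl , refl)
shadow-exists k (suc N) with macaulayRep k (suc N)
... | a ∷ as , rep , binom≡N = shadowSum (suc k) (a ∷ as) ,
  inj₂ (a ∷ as , (s≤s z≤n , Macaulay-length≤ rep , Macaulay-linked rep , Macaulay-lowerBound rep , binom≡N) , refl)

-- Primes, roughness and square-free numbers

prime⇒2≤ : ∀ {p} → Prime p → 2 ≤ p
prime⇒2≤ {p} pp = nonTrivial⇒n>1 p {{prime⇒nonTrivial pp}}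

prime∤⇒coprime : ∀ {p n} → Prime p → ¬ p ∣ n → Coprime p n
prime∤⇒coprime pp p∤n (i∣p , i∣n) with prime⇒irreducible pp i∣p
... | inj₁ i≡1  = i≡1
... | inj₂ refl = contradiction i∣n p∤n

rough? : ∀ p m → Dec (p Rough m)
rough? p m = ¬? (map′ from to (anyUpTo? (λ d → nonTrivial? d ×-dec d ∣? m) p))
  where
  from : ∃[ d ] d < p × NonTrivial d × d ∣ m → m HasNonTrivialDivisorLessThan p
  from (_ , d<p , nt , d∣m) = hasNonTrivialDivisor {{nt}} d<p d∣m
  to : m HasNonTrivialDivisorLessThan p → ∃[ d ] d < p × NonTrivial d × d ∣ m
  to (hasNonTrivialDivisor d<p d∣m) = _ , d<p , n>1⇒nonTrivial (nonTrivial⇒n>1 _) , d∣m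

rough-suc⇒rough : ∀ {p m} → suc p Rough m → p Rough m
rough-suc⇒rough {p} r h = r (hasNonTrivialDivisor-≤ h (n≤1+n p))

rough-suc⇒∤ : ∀ {p m} → 2 ≤ p → suc p Rough m → ¬ p ∣ m
rough-suc⇒∤ 2≤p r p∣m = r (hasNonTrivialDivisor {{n>1⇒nonTrivial 2≤p}} ≤-refl p∣m)

nonprime∧rough⇒∤ : ∀ {p m} → ¬ Prime p → 2 ≤ p → p Rough m → ¬ p ∣ m
nonprime∧rough⇒∤ ¬pp 2≤p r p∣m = ¬pp (rough∧∣⇒prime {{n>1⇒nonTrivial 2≤p}} r p∣m)

rough-* : ∀ {p m} → Prime p → suc p Rough m → p Rough (p * m)
rough-* pp r (hasNonTrivialDivisor {d} d<p d∣pm) = r (hasNonTrivialDivisor (m<n⇒m<1+n d<p)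
  (coprime-divisor (coprime-sym (prime⇒coprime pp {{nonTrivial⇒nonZero d}} d<p)) d∣pm))

squareFree⇒¬square∣ : ∀ {m d} → 1 ≤ m → SquareFree m → 2 ≤ d → ¬ d * d ∣ m
squareFree⇒¬square∣ {suc _} {d} _ sf 2≤d dd∣m = sf (s≤s (∣⇒≤ (∣-trans (m∣m*n d) dd∣m))) 2≤d dd∣m

squareFree-*⇒∤ : ∀ {p m} → Prime p → 1 ≤ m → SquareFree (p * m) → ¬ p ∣ m
squareFree-*⇒∤ {p} pp 1≤m sf p∣m =
  squareFree⇒¬square∣ (*-mono-≤ (<⇒≤ (prime⇒2≤ pp)) 1≤m) sf (prime⇒2≤ pp) (*-monoʳ-∣ p p∣m)

squareFree-*⇒squareFree : ∀ {p m} .{{_ : NonZero p}} → SquareFree (p * m) → SquareFree m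
squareFree-*⇒squareFree {p} {m} sf d<1+m 2≤d dd∣m =
  sf (≤-trans d<1+m (s≤s (m≤n*m m p))) 2≤d (∣n⇒∣m*n p dd∣m)

squareFree-* : ∀ {p m} → Prime p → ¬ p ∣ m → 1 ≤ m → SquareFree m → SquareFree (p * m)
squareFree-* {p} {m} pp p∤m 1≤m sf {d} _ 2≤d dd∣pm with p ∣? d
... | yes p∣d = p∤m (*-cancelˡ-∣ p {{prime⇒nonZero pp}} (∣-trans (*-pres-∣ p∣d p∣d) dd∣pm))
... | no  p∤d = squareFree⇒¬square∣ 1≤m sf 2≤d
  (coprime-divisor (coprime-sym (prime∤⇒coprime pp ([ p∤d , p∤d ]′ ∘ euclidsLemma d d pp))) dd∣pm)

PrimeDivisor : ℕ → Pred ℕ 0ℓ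
PrimeDivisor m q = Prime q × q ∣ m

primeDivisor? : ∀ m → Decidable (PrimeDivisor m)
primeDivisor? m q = prime? q ×-dec q ∣? m

ω-count : ∀ {m N} → 1 ≤ m → m ≤ N → count (primeDivisor? m) (suc N) ≡ ω m
ω-count {suc m} _ m≤N = count-stable (primeDivisor? (suc m)) (s≤s m≤N) (λ m<q (_ , q∣m) → <⇒≱ m<q (∣⇒≤ q∣m))

ω-* : ∀ {p m} → Prime p → ¬ p ∣ m → 1 ≤ m → ω (p * m) ≡ suc (ω m)
ω-* {p} {m} pp p∤m 1≤m = begin
  count (primeDivisor? (p * m)) N           ≡⟨ count-split (primeDivisor? (p * m)) (_≟ p) N ⟩
  count is-p? N + count other? N            ≡⟨ cong₂ _+_ (count-cong is-p? (_≟ p) N (λ _ → proj₂) (λ _ → is-p))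
                                                           (count-cong other? (primeDivisor? m) N (λ _ → other) (λ _ → other⁻¹)) ⟩
  count (_≟ p) N + count (primeDivisor? m) N ≡⟨ cong₂ _+_ (count-≟ p<N) (ω-count 1≤m m≤pm) ⟩
  1 + ω m                                   ∎
  where
  open ≡-Reasoning
  N = suc (p * m)
  m≤pm : m ≤ p * m
  m≤pm = m≤n*m m p {{prime⇒nonZero pp}}
  p<N : p < N
  p<N = s≤s (m≤m*n p m {{>-nonZero 1≤m}})
  is-p? = λ q → primeDivisor? (p * m) q ×-dec q ≟ p
  other? = λ q → primeDivisor? (p * m) q ×-dec ¬? (q ≟ p)
  is-p : ∀ {q} → q ≡ p → PrimeDivisor (p * m) q × q ≡ p
  is-p refl = (pp , m∣m*n m) , refl
  other : ∀ {q} → PrimeDivisor (p * m) q × q ≢ p → PrimeDivisor m q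
  other ((pq , q∣pm) , q≢p) with euclidsLemma p m pq q∣pm
  ... | inj₁ q∣p = ⊥-elim ([ (λ { refl → ¬prime[1] pq }) , q≢p ]′ (prime⇒irreducible pp q∣p))
  ... | inj₂ q∣m = pq , q∣m
  other⁻¹ : ∀ {q} → PrimeDivisor m q → PrimeDivisor (p * m) q × q ≢ p
  other⁻¹ (pq , q∣m) = (pq , ∣n⇒∣m*n p q∣m) , λ { refl → p∤m q∣m }

-- Counting square-free rough numbers

module _ (n : ℕ) where

  Admissible : ℕ → ℕ → ℕ → Pred ℕ 0ℓ
  Admissible t c p m = 1 ≤ m × SquareFree m × ω m ≡ t × p Rough m × c * m ≤ n

  admissible? : ∀ t c p → Decidable (Admissible t c p)
  admissible? t c p m = 1 ≤? m ×-dec squareFree? m ×-dec ω m ≟ t ×-dec rough? p m ×-dec c * m ≤? n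

  #admissible : ℕ → ℕ → ℕ → ℕ
  #admissible t c p = count (admissible? t c p) (suc n)

  admissible⇒≤ : ∀ {t c p m} → 1 ≤ c → Admissible t c p m → m ≤ n
  admissible⇒≤ {m = m} 1≤c (_ , _ , _ , _ , cm≤n) = ≤-trans (m≤n*m m _ {{>-nonZero 1≤c}}) cm≤n

  admissible-p*→ : ∀ {t c p m} → Prime p → Admissible (suc t) c p (p * m) → Admissible t (c * p) (suc p) m
  admissible-p*→ {t} {c} {p} {m} pp (1≤pm , sf , ω≡ , r , cpm≤n) =
    1≤m , squareFree-*⇒squareFree {{prime⇒nonZero pp}} sf , suc-injective (trans (sym (ω-* pp p∤m 1≤m)) ω≡) ,
    ∤⇒rough-suc p∤m (rough∧∣⇒rough r (n∣m*n p)) , subst (_≤ n) (sym (*-assoc c p m)) cpm≤n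
    where
    1≤m : 1 ≤ m
    1≤m = n≢0⇒n>0 (λ { refl → contradiction (subst (1 ≤_) (*-zeroʳ p) 1≤pm) λ () })
    p∤m = squareFree-*⇒∤ pp 1≤m sf

  admissible-p*← : ∀ {t c p m} → Prime p → Admissible t (c * p) (suc p) m → Admissible (suc t) c p (p * m)
  admissible-p*← {t} {c} {p} {m} pp (1≤m , sf , ω≡ , r , cpm≤n) =
    *-mono-≤ (<⇒≤ (prime⇒2≤ pp)) 1≤m , squareFree-* pp p∤m 1≤m sf , trans (ω-* pp p∤m 1≤m) (cong suc ω≡) ,
    rough-* pp r , subst (_≤ n) (*-assoc c p m) cpm≤n
    where p∤m = rough-suc⇒∤ (prime⇒2≤ pp) r

  #admissible-split : ∀ {t c p} → Prime p → 1 ≤ c →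
    #admissible (suc t) c p ≡ #admissible t (c * p) (suc p) + #admissible (suc t) c (suc p)
  #admissible-split {t} {c} {p} pp 1≤c = begin
    count A? N                                                                   ≡⟨ count-split A? (p ∣?_) N ⟩
    count (λ m → A? m ×-dec p ∣? m) N + count (λ m → A? m ×-dec ¬? (p ∣? m)) N ≡⟨ cong₂ _+_ multiples non-multiples ⟩
    #admissible t (c * p) (suc p) + #admissible (suc t) c (suc p)                ∎
    where
    open ≡-Reasoning
    instance _ = prime⇒nonZero pp
    A? = admissible? (suc t) c p
    N = suc n
    multiples : count (λ m → A? m ×-dec p ∣? m) N ≡ #admissible t (c * p) (suc p)
    multiples = begin
      count (λ m → A? m ×-dec p ∣? m) N       ≡⟨ count-stable (λ m → A? m ×-dec p ∣? m) (m≤n*m N p) (λ N≤m (adm , _) → <⇒≱ N≤m (admissible⇒≤ 1≤c adm)) ⟨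
      count (λ m → A? m ×-dec p ∣? m) (p * N) ≡⟨ count-multiples A? p N ⟩
      count (A? ∘ (p *_)) N                   ≡⟨ count-cong (A? ∘ (p *_)) (admissible? t (c * p) (suc p)) N
                                                   (λ _ → admissible-p*→ {c = c} pp) (λ _ → admissible-p*← {c = c} pp) ⟩
      #admissible t (c * p) (suc p)           ∎
    non-multiples : count (λ m → A? m ×-dec ¬? (p ∣? m)) N ≡ #admissible (suc t) c (suc p)
    non-multiples = count-cong (λ m → A? m ×-dec ¬? (p ∣? m)) (admissible? (suc t) c (suc p)) N
      (λ _ ((1≤m , sf , ω≡t , r , cm≤n) , p∤) → 1≤m , sf , ω≡t , ∤⇒rough-suc p∤ r , cm≤n)
      (λ _ (1≤m , sf , ω≡t , r , cm≤n) → (1≤m , sf , ω≡t , rough-suc⇒rough r , cm≤n) , rough-suc⇒∤ (prime⇒2≤ pp) r)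

  #admissible-nonprime : ∀ {t c p} → ¬ Prime p → 2 ≤ p → #admissible t c p ≡ #admissible t c (suc p)
  #admissible-nonprime {t} {c} {p} ¬pp 2≤p = count-cong (admissible? t c p) (admissible? t c (suc p)) (suc n)
    (λ _ (1≤m , sf , ω≡t , r , cm≤n) → 1≤m , sf , ω≡t , ∤⇒rough-suc (nonprime∧rough⇒∤ ¬pp 2≤p r) r , cm≤n)
    (λ _ (1≤m , sf , ω≡t , r , cm≤n) → 1≤m , sf , ω≡t , rough-suc⇒rough r , cm≤n)

  #admissible-antitoneᵖ : ∀ {t c p} → #admissible t c (suc p) ≤ #admissible t c p
  #admissible-antitoneᵖ {t} {c} {p} = count-mono (admissible? t c (suc p)) (admissible? t c p) (suc n)
    (λ _ (1≤m , sf , ω≡t , r , cm≤n) → 1≤m , sf , ω≡t , rough-suc⇒rough r , cm≤n)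

  #admissible-antitoneᶜ : ∀ {t c c′ p} → c′ ≤ c → #admissible t c p ≤ #admissible t c′ p
  #admissible-antitoneᶜ {t} {c} {c′} {p} c′≤c = count-mono (admissible? t c p) (admissible? t c′ p) (suc n)
    (λ { {m} _ (1≤m , sf , ω≡t , r , cm≤n) → 1≤m , sf , ω≡t , r , ≤-trans (*-monoˡ-≤ m c′≤c) cm≤n })

  #admissible-empty : ∀ {t c p} → n < p → #admissible (suc t) c p ≡ 0
  #admissible-empty {t} {c} {p} n<p = count-≡0 (admissible? (suc t) c p) (suc n) not-admissible
    where
    not-admissible : ∀ {m} → m < suc n → ¬ Admissible (suc t) c p m
    not-admissible {1}          _     (_ , _ , () , _)
    not-admissible {suc (suc _)} m<1+n (_ , _ , _ , r , _) = r (hasNonTrivialDivisor (<-≤-trans m<1+n n<p) ∣-refl)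

  -- By induction on f with n < f + p: once p exceeds n the families are empty.
  ShadowBound : ℕ → Set
  ShadowBound f = ∀ {t c c′ p as} → n < f + p → 2 ≤ p → 1 ≤ c → 1 ≤ c′ → c′ ≤ c * p →
    Macaulay (suc t) as → binomSum (suc t) as ≤ #admissible (suc t) c p →
    kkShadow (suc t) as ≤ #admissible t c′ p

  StarBound : ℕ → Set
  StarBound f = ∀ {t c p as} → n < f + p → Prime p → 1 ≤ c →
    Macaulay (suc t) as → binomSum (suc t) as ≤ #admissible (suc t) c p →
    starSum (suc t) as ≤ #admissible t (c * p) (suc p)

  shadowBound-0 : ShadowBound 0
  shadowBound-0 _ _ _ _ _ [] _ = z≤n
  shadowBound-0 {t} {c} {as = _ ∷ _} n<p _ _ _ _ rep binom≤ =
    ⊥-elim (<⇒≱ (0<binomSum rep) (≤-trans binom≤ (≤-reflexive (#admissible-empty {t} {c} n<p))))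

  private
    n<f+[1+p] : ∀ {f p} → n < suc f + p → n < f + suc p
    n<f+[1+p] {f} {p} = subst (n <_) (sym (+-suc f p))

  starBound-suc : ∀ {f} → ShadowBound f → StarBound (suc f)
  starBound-suc _ _ _ _ [] _ = z≤n
  starBound-suc shadowBound {t} {c} {p} {a ∷ as} n<1+f+p pp 1≤c rep binom≤
    with starSum (suc t) (a ∷ as) ≤? #admissible t (c * p) (suc p)
  ... | yes star≤ = star≤
  ... | no  star≰ with b , bs , repb , binomb≤ , star≤kk ← starSum≤kkShadow[1+shadowSum] rep =
    ≤-trans star≤kk (shadowBound (n<f+[1+p] n<1+f+p) (m≤n⇒m≤1+n (prime⇒2≤ pp)) 1≤c
                                 (*-mono-≤ 1≤c (<⇒≤ (prime⇒2≤ pp))) (*-monoʳ-≤ c (n≤1+n p))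
                                 repb (≤-trans binomb≤ 1+lo≤B))
    where
    A = #admissible t (c * p) (suc p)
    B = #admissible (suc t) c (suc p)
    lo = shadowSum (suc t) (a ∷ as)
    1+lo≤B : suc lo ≤ B
    1+lo≤B = +-cancelˡ-≤ A _ _ (begin
      A + suc lo                    ≡⟨ +-suc A lo ⟩
      suc A + lo                    ≤⟨ +-monoˡ-≤ lo (≰⇒> star≰) ⟩
      starSum (suc t) (a ∷ as) + lo ≡⟨ binomSum≡starSum+shadowSum rep ⟨
      binomSum (suc t) (a ∷ as)     ≤⟨ binom≤ ⟩
      #admissible (suc t) c p       ≡⟨ #admissible-split pp 1≤c ⟩
      A + B                         ∎)
      where open ≤-Reasoning

  private
    shadowBound-suc-prime : ∀ {f} → ShadowBound f → ∀ {t c c′ p as} → n < suc f + p → Prime p →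
      1 ≤ c → 1 ≤ c′ → c′ ≤ c * p → Macaulay (suc t) as → binomSum (suc t) as ≤ #admissible (suc t) c p →
      kkShadow (suc t) as ≤ #admissible t c′ p
    shadowBound-suc-prime _ {zero} _ _ _ _ _ [] _ = z≤n
    shadowBound-suc-prime shadowBound {zero} {c} {c′} {p} n<1+f+p pp 1≤c _ c′≤cp rep@([-] _) binom≤ =
      ≤-trans (starBound-suc shadowBound n<1+f+p pp 1≤c rep binom≤)
              (≤-trans (#admissible-antitoneᶜ {0} {c * p} {c′} c′≤cp) (#admissible-antitoneᵖ {0} {c′} {p}))
    shadowBound-suc-prime shadowBound {suc t} {c} {c′} {p} {as} n<1+f+p pp 1≤c 1≤c′ c′≤cp rep binom≤ = begin
      kkShadow (2+ t) as                                               ≡⟨ kkShadow≡kkShadow[lowerRep]+starSum rep ⟩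
      kkShadow (suc t) (lowerRep (2+ t) as) + starSum (2+ t) as         ≤⟨ +-mono-≤ lower≤ (≤-trans star≤ (#admissible-antitoneᶜ c′≤cp)) ⟩
      #admissible t (c′ * p) (suc p) + #admissible (suc t) c′ (suc p)   ≡⟨ #admissible-split pp 1≤c′ ⟨
      #admissible (suc t) c′ p                                         ∎
      where
      open ≤-Reasoning
      1≤p = <⇒≤ (prime⇒2≤ pp)
      star≤ : starSum (2+ t) as ≤ #admissible (suc t) (c * p) (suc p)
      star≤ = starBound-suc shadowBound n<1+f+p pp 1≤c rep binom≤
      lower≤ : kkShadow (suc t) (lowerRep (2+ t) as) ≤ #admissible t (c′ * p) (suc p)
      lower≤ = shadowBound (n<f+[1+p] n<1+f+p) (m≤n⇒m≤1+n (prime⇒2≤ pp)) (*-mono-≤ 1≤c 1≤p) (*-mono-≤ 1≤c′ 1≤p)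
                           (≤-trans (*-monoˡ-≤ p c′≤cp) (*-monoʳ-≤ (c * p) (n≤1+n p)))
                           (lowerRep-Macaulay rep) (≤-trans (binomSum[lowerRep]≤starSum rep) star≤)

  shadowBound-suc : ∀ {f} → ShadowBound f → ShadowBound (suc f)
  shadowBound-suc shadowBound {t} {c} {c′} {p} {as} n<1+f+p 2≤p 1≤c 1≤c′ c′≤cp rep binom≤ with prime? p
  ... | yes pp = shadowBound-suc-prime shadowBound n<1+f+p pp 1≤c 1≤c′ c′≤cp rep binom≤
  ... | no ¬pp rewrite #admissible-nonprime {t} {c′} ¬pp 2≤p =
    shadowBound (n<f+[1+p] n<1+f+p) (m≤n⇒m≤1+n 2≤p) 1≤c 1≤c′ (≤-trans c′≤cp (*-monoʳ-≤ c (n≤1+n p)))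
                rep (subst (binomSum (suc t) as ≤_) (#admissible-nonprime {suc t} {c} ¬pp 2≤p) binom≤)

  shadowBound : ∀ f → ShadowBound f
  shadowBound zero    = shadowBound-0
  shadowBound (suc f) = shadowBound-suc (shadowBound f)

  oddPart≤shadowSum : ∀ {k as} → Macaulay (suc k) as → binomSum (suc k) as ≡ #admissible (suc k) 1 2 →
                      #admissible (suc k) 1 3 ≤ shadowSum (suc k) as
  oddPart≤shadowSum {k} {as} rep binom≡ = +-cancelˡ-≤ (starSum (suc k) as) _ _ (begin
    starSum (suc k) as + #admissible (suc k) 1 3         ≤⟨ +-monoˡ-≤ _ star≤ ⟩
    #admissible k 2 3 + #admissible (suc k) 1 3          ≡⟨ #admissible-split prime[2] ≤-refl ⟨
    #admissible (suc k) 1 2                              ≡⟨ binom≡ ⟨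
    binomSum (suc k) as                                  ≡⟨ binomSum≡starSum+shadowSum rep ⟩
    starSum (suc k) as + shadowSum (suc k) as            ∎)
    where
    open ≤-Reasoning
    star≤ : starSum (suc k) as ≤ #admissible k 2 3
    star≤ = starBound-suc (shadowBound n) (≤-trans (n<1+n n) (m≤m+n (suc n) 2)) prime[2] ≤-refl rep (≤-reflexive binom≡)

σ≡#admissible : ∀ t n → σ t n ≡ #admissible n t 1 2
σ≡#admissible t n = count-cong (λ m → 1 ≤? m ×-dec squareFree? m ×-dec ω m ≟ t) (admissible? n t 1 2) (suc n)
  (λ { {m} m<1+n (1≤m , sf , ω≡t) → 1≤m , sf , ω≡t , 2-rough , subst (_≤ n) (sym (*-identityˡ m)) (≤-pred m<1+n) })
  (λ _ (1≤m , sf , ω≡t , _ , _) → 1≤m , sf , ω≡t)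

σodd≡#admissible : ∀ t n → σodd t n ≡ #admissible n t 1 3
σodd≡#admissible t n = count-cong (λ m → 1 ≤? m ×-dec ¬? (2 ∣? m) ×-dec squareFree? m ×-dec ω m ≟ t)
  (admissible? n t 1 3) (suc n)
  (λ { {m} m<1+n (1≤m , odd , sf , ω≡t) → 1≤m , sf , ω≡t , ∤⇒rough-suc odd 2-rough , subst (_≤ n) (sym (*-identityˡ m)) (≤-pred m<1+n) })
  (λ _ (1≤m , sf , ω≡t , r , _) → 1≤m , rough-suc⇒∤ ≤-refl r , sf , ω≡t)

corollary1p7 : (n : ℕ) → 1 ≤ n → (k : ℕ) → 1 ≤ k →
    Σ ℕ (λ d → IsShadow k (σ (suc k) n) d)
    × ((d : ℕ) → IsShadow k (σ (suc k) n) d → σodd (suc k) n ≤ d)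
corollary1p7 n _ k _ = shadow-exists k (σ (suc k) n) , σodd≤shadow
  where
  σodd≤shadow : (d : ℕ) → IsShadow k (σ (suc k) n) d → σodd (suc k) n ≤ d
  σodd≤shadow d (inj₁ (σ≡0 , refl)) = begin
    σodd (suc k) n               ≡⟨ σodd≡#admissible (suc k) n ⟩
    #admissible n (suc k) 1 3    ≤⟨ #admissible-antitoneᵖ n {suc k} {1} {2} ⟩
    #admissible n (suc k) 1 2    ≡⟨ σ≡#admissible (suc k) n ⟨
    σ (suc k) n                  ≡⟨ σ≡0 ⟩
    0                            ∎
    where open ≤-Reasoning
  σodd≤shadow d (inj₂ (as , isRep@(_ , _ , _ , _ , binom≡σ) , refl)) =
    subst (_≤ d) (sym (σodd≡#admissible (suc k) n))
      (oddPart≤shadowSum n (isMacaulayRep⇒Macaulay isRep) (trans binom≡σ (σ≡#admissible (suc k) n)))
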